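{- Let $K\leq\mathrm{Aut}(Q_n)$ and $\Pi:=(Q_n)_K$. If $d_K\geq 2\ell$ for some positive integer $\ell$, then $$\Pi_\ell(x^K)=\{(x+e)^K: e\in\mathbb{F}_2^n,\ \mathrm{wt}(e)=\ell\}$$ for all $x\in\mathbb{F}_2^n$.
   Context: The $n$-cube $Q_n$ has vertex set $\mathbb{F}_2^n$, two vectors adjacent iff their Hamming distance is $1$; $\mathrm{Aut}(Q_n)=\mathbb{F}_2^n: S_n$. $\mathrm{wt}(e)$ is the number of non-zero coordinates of $e$. For $K\leq\mathrm{Aut}(Q_n)$, $d_K:=\min\{d_{Q_n}(x,x^k): x\in\mathbb{F}_2^n,\ 1\neq k\in K\}$ if $K\neq 1$ and $d_K:=\infty$ if $K=1$. The normal quotient $(Q_n)_K$ is the simple graph whose vertices are the $K$-orbits $x^K$, distinct orbits adjacent iff some vertex of one is adjacent in $Q_n$ to some vertex of the other. $\Pi_\ell(u)$ is the set of vertices at distance exactly $\ell$ from $u$ in $\Pi$. -}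

module Defs where

open import Data.Nat using (ℕ; zero; suc; _+_; _*_; _<_; _≥_)
open import Data.Bool using (Bool; true; false; _xor_)
open import Data.Fin using (Fin)
open import Data.Vec using (Vec; []; _∷_; tabulate; lookup; zipWith; replicate)
open import Data.Fin.Permutation using (Permutation′; _⟨$⟩ʳ_; _⟨$⟩ˡ_; _∘ₚ_; flip)
  renaming (id to idₚ)
open import Data.Product using (Σ; ∃; _×_; _,_)
open import Relation.Nullary using (¬_)
open import Relation.Binary.PropositionalEquality using (_≡_)

V : ℕ → Set
V n = Vec Bool n

_⊕_ : ∀ {n} → V n → V n → V n
_⊕_ = zipWith _xor_

𝟎 : ∀ {n} → V n
𝟎 = replicate _ false

wt : ∀ {n} → V n → ℕ
wt [] = 0
wt (true ∷ e) = suc (wt e)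
wt (false ∷ e) = wt e

AdjQ : ∀ {n} → V n → V n → Set
AdjQ x y = wt (x ⊕ y) ≡ 1

-- Graph distance, for a graph given by a vertex type, an equivalence
-- relation _≈_ on it (vertex equality) and an adjacency relation.

Walk : ∀ {A : Set} → (A → A → Set) → (A → A → Set) → ℕ → A → A → Set
Walk _≈_ Adj zero u v = u ≈ v
Walk _≈_ Adj (suc m) u w = ∃ λ v → Adj u v × Walk _≈_ Adj m v w

Dist : ∀ {A : Set} → (A → A → Set) → (A → A → Set) → A → A → ℕ → Set
Dist _≈_ Adj u v m =
  Walk _≈_ Adj m u v × (∀ j → j < m → ¬ Walk _≈_ Adj j u v)

DistQ≥ : ∀ {n} → V n → V n → ℕ → Set
DistQ≥ x y m = ∀ j → j < m → ¬ Walk _≡_ AdjQ j x y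

-- Aut(Q_n) = F_2^n : S_n. The element (a , σ) acts by x ↦ x^σ + a,
-- where (x^σ)_i = x_{σ⁻¹(i)}.

Aut : ℕ → Set
Aut n = V n × Permutation′ n

permute : ∀ {n} → Permutation′ n → V n → V n
permute σ x = tabulate (λ i → lookup x (σ ⟨$⟩ˡ i))

act : ∀ {n} → Aut n → V n → V n
act (a , σ) x = permute σ x ⊕ a

-- Group operations: act (k · k') = act k' ∘ act k  (right action).
_·_ : ∀ {n} → Aut n → Aut n → Aut n
(a , σ) · (b , τ) = (permute τ a ⊕ b , σ ∘ₚ τ)

inv : ∀ {n} → Aut n → Aut n
inv (a , σ) = (permute (flip σ) a , flip σ)

one : ∀ {n} → Aut n
one = (𝟎 , idₚ)

IsOne : ∀ {n} → Aut n → Set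
IsOne (a , σ) = (a ≡ 𝟎) × (∀ i → σ ⟨$⟩ʳ i ≡ i)

record IsSubgroup {n : ℕ} (K : Aut n → Set) : Set where
  field
    one∈ : K one
    ·∈   : ∀ {k k'} → K k → K k' → K (k · k')
    inv∈ : ∀ {k} → K k → K (inv k)

-- d_K ≥ m  (d_K = min over x and nonidentity k ∈ K of d(x, x^k);
-- d_K = ∞ if K = 1, in which case this holds vacuously).
dK≥ : ∀ {n} → (Aut n → Set) → ℕ → Set
dK≥ {n} K m = ∀ (x : V n) (k : Aut n) → K k → ¬ IsOne k → DistQ≥ x (act k x) m

-- Normal quotient Π = (Q_n)_K, with vertices (K-orbits) represented
-- by representatives: x^K = y^K  iff  y = x^k for some k ∈ K.

SameOrbit : ∀ {n} → (Aut n → Set) → V n → V n → Set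
SameOrbit K x y = ∃ λ k → K k × act k x ≡ y

AdjΠ : ∀ {n} → (Aut n → Set) → V n → V n → Set
AdjΠ K x y = ¬ SameOrbit K x y ×
  (∃ λ x' → ∃ λ y' → SameOrbit K x x' × SameOrbit K y y' × AdjQ x' y')

InSphereΠ : ∀ {n} → (Aut n → Set) → ℕ → V n → V n → Set
InSphereΠ K ℓ x y = Dist (SameOrbit K) (AdjΠ K) x y ℓ

-- Since d_K ≥ 2, no edge of Q_n joins two vertices of one K-orbit, so every walk
-- of Q_n projects to a walk of Π of the same length; conversely, translating each
-- step by an element of K lifts a walk of Π from x^K to y^K to a walk of Q_n from
-- x to some representative of y^K.  Hence the distance from x^K to y^K in Π is the
-- least Hamming distance from x to a representative of y^K.  Finally, distinct
-- representatives of one orbit are at Hamming distance ≥ d_K ≥ 2ℓ, so if x + e with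
-- wt e = ℓ lies in y^K, the triangle inequality puts every representative of y^K at
-- distance ≥ ℓ from x.
module Submission where

open import Defs
open import Data.Nat using (ℕ; zero; suc; _+_; _*_; _≤_; _<_; z≤n; s≤s)
open import Data.Nat.Properties
open import Data.Bool using (Bool; true; false; _xor_)
import Data.Bool.Properties as Bool
import Data.Fin as Fin
open Fin using (Fin)
open import Data.Vec using ([]; _∷_; tabulate; lookup; zipWith)
open import Data.Vec.Properties
  using ( lookup-zipWith; lookup∘tabulate; tabulate∘lookup; tabulate-cong
        ; zipWith-assoc; zipWith-comm; zipWith-identityˡ; zipWith-identityʳ; ≡-dec)
open import Data.Fin.Permutation using (Permutation′; _⟨$⟩ʳ_; _⟨$⟩ˡ_; _∘ₚ_; flip; inverseˡ; inverseʳ)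
open import Data.Product using (∃; _×_; _,_)
open import Function.Bundles using (_⇔_; mk⇔)
import Function.Properties.Equivalence as ⇔
open import Relation.Nullary using (¬_; yes; no)
open import Relation.Binary.PropositionalEquality
  using (_≡_; _≢_; refl; sym; trans; cong; cong₂; subst; module ≡-Reasoning)
import Algebra.Properties.CommutativeMonoid.Sum as Sum

⊕-assoc : ∀ {n} (x y z : V n) → (x ⊕ y) ⊕ z ≡ x ⊕ (y ⊕ z)
⊕-assoc = zipWith-assoc Bool.xor-assoc

⊕-comm : ∀ {n} (x y : V n) → x ⊕ y ≡ y ⊕ x
⊕-comm = zipWith-comm Bool.xor-comm

⊕-identityˡ : ∀ {n} (x : V n) → 𝟎 ⊕ x ≡ x
⊕-identityˡ = zipWith-identityˡ Bool.xor-identityˡ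

⊕-identityʳ : ∀ {n} (x : V n) → x ⊕ 𝟎 ≡ x
⊕-identityʳ = zipWith-identityʳ Bool.xor-identityʳ

⊕-self : ∀ {n} (x : V n) → x ⊕ x ≡ 𝟎
⊕-self []      = refl
⊕-self (b ∷ x) = cong₂ _∷_ (Bool.xor-same b) (⊕-self x)

⊕-cancelˡ : ∀ {n} (x e : V n) → x ⊕ (x ⊕ e) ≡ e
⊕-cancelˡ x e = begin
  x ⊕ (x ⊕ e) ≡⟨ ⊕-assoc x x e ⟨
  (x ⊕ x) ⊕ e ≡⟨ cong (_⊕ e) (⊕-self x) ⟩
  𝟎 ⊕ e       ≡⟨ ⊕-identityˡ e ⟩
  e           ∎
  where open ≡-Reasoning

⊕-cancelʳ : ∀ {n} (x a : V n) → (x ⊕ a) ⊕ a ≡ x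
⊕-cancelʳ x a = begin
  (x ⊕ a) ⊕ a ≡⟨ ⊕-assoc x a a ⟩
  x ⊕ (a ⊕ a) ≡⟨ cong (x ⊕_) (⊕-self a) ⟩
  x ⊕ 𝟎       ≡⟨ ⊕-identityʳ x ⟩
  x           ∎
  where open ≡-Reasoning

⊕-telescope : ∀ {n} (x y z : V n) → (x ⊕ y) ⊕ (y ⊕ z) ≡ x ⊕ z
⊕-telescope x y z = trans (⊕-assoc x y (y ⊕ z)) (cong (x ⊕_) (⊕-cancelˡ y z))

zipWith-tabulate : ∀ {A B C : Set} {n} (f : A → B → C) (g : Fin n → A) (h : Fin n → B) →
                   zipWith f (tabulate g) (tabulate h) ≡ tabulate (λ i → f (g i) (h i))
zipWith-tabulate {n = zero}  f g h = refl
zipWith-tabulate {n = suc n} f g h =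
  cong (f (g Fin.zero) (h Fin.zero) ∷_) (zipWith-tabulate f (λ i → g (Fin.suc i)) (λ i → h (Fin.suc i)))

permute-⊕ : ∀ {n} (σ : Permutation′ n) (x y : V n) → permute σ (x ⊕ y) ≡ permute σ x ⊕ permute σ y
permute-⊕ σ x y = trans (tabulate-cong λ i → lookup-zipWith _xor_ (σ ⟨$⟩ˡ i) x y)
                        (sym (zipWith-tabulate _xor_ _ _))

permute-∘ : ∀ {n} (σ τ : Permutation′ n) (x : V n) → permute (σ ∘ₚ τ) x ≡ permute τ (permute σ x)
permute-∘ σ τ x = tabulate-cong λ i → sym (lookup∘tabulate _ (τ ⟨$⟩ˡ i))

permute-flip : ∀ {n} (σ : Permutation′ n) (x : V n) → permute (flip σ) (permute σ x) ≡ x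
permute-flip σ x =
  trans (tabulate-cong λ i → trans (lookup∘tabulate _ (σ ⟨$⟩ʳ i)) (cong (lookup x) (inverseˡ σ)))
        (tabulate∘lookup x)

permute-id : ∀ {n} (σ : Permutation′ n) → (∀ i → σ ⟨$⟩ʳ i ≡ i) → ∀ x → permute σ x ≡ x
permute-id σ fixed x =
  trans (tabulate-cong λ i → cong (lookup x) (trans (sym (fixed (σ ⟨$⟩ˡ i))) (inverseʳ σ)))
        (tabulate∘lookup x)

bit : Bool → ℕ
bit true  = 1
bit false = 0

open Sum +-0-commutativeMonoid using (sum; sum-permute; sum-cong-≗)

wt-sum : ∀ {n} (v : V n) → wt v ≡ sum (λ i → bit (lookup v i))
wt-sum []          = refl
wt-sum (true ∷ v)  = cong suc (wt-sum v)
wt-sum (false ∷ v) = wt-sum v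

wt-permute : ∀ {n} (σ : Permutation′ n) (v : V n) → wt (permute σ v) ≡ wt v
wt-permute σ v = begin
  wt (permute σ v)                          ≡⟨ wt-sum (permute σ v) ⟩
  sum (λ i → bit (lookup (permute σ v) i))
    ≡⟨ sum-cong-≗ (λ i → cong bit (lookup∘tabulate (λ j → lookup v (σ ⟨$⟩ˡ j)) i)) ⟩
  sum (λ i → bit (lookup v (σ ⟨$⟩ˡ i)))     ≡⟨ sum-permute (λ i → bit (lookup v i)) (flip σ) ⟨
  sum (λ i → bit (lookup v i))              ≡⟨ wt-sum v ⟨
  wt v                                      ∎
  where open ≡-Reasoning

act-· : ∀ {n} (k k′ : Aut n) x → act (k · k′) x ≡ act k′ (act k x)
act-· (a , σ) (b , τ) x = begin
  permute (σ ∘ₚ τ) x ⊕ (permute τ a ⊕ b)          ≡⟨ cong (_⊕ (permute τ a ⊕ b)) (permute-∘ σ τ x) ⟩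
  permute τ (permute σ x) ⊕ (permute τ a ⊕ b)     ≡⟨ ⊕-assoc (permute τ (permute σ x)) (permute τ a) b ⟨
  (permute τ (permute σ x) ⊕ permute τ a) ⊕ b     ≡⟨ cong (_⊕ b) (permute-⊕ τ (permute σ x) a) ⟨
  permute τ (permute σ x ⊕ a) ⊕ b                 ∎
  where open ≡-Reasoning

act-inv : ∀ {n} (k : Aut n) x → act (inv k) (act k x) ≡ x
act-inv (a , σ) x = begin
  permute (flip σ) (permute σ x ⊕ a) ⊕ permute (flip σ) a
    ≡⟨ cong (_⊕ permute (flip σ) a) (permute-⊕ (flip σ) (permute σ x) a) ⟩
  (permute (flip σ) (permute σ x) ⊕ permute (flip σ) a) ⊕ permute (flip σ) a
    ≡⟨ ⊕-cancelʳ (permute (flip σ) (permute σ x)) (permute (flip σ) a) ⟩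
  permute (flip σ) (permute σ x)
    ≡⟨ permute-flip σ x ⟩
  x ∎
  where open ≡-Reasoning

act-identity : ∀ {n} (k : Aut n) → IsOne k → ∀ x → act k x ≡ x
act-identity (a , σ) (refl , fixed) x = trans (⊕-identityʳ (permute σ x)) (permute-id σ fixed x)

act-one : ∀ {n} (x : V n) → act one x ≡ x
act-one = act-identity one (refl , λ _ → refl)

dist : ∀ {n} → V n → V n → ℕ
dist x y = wt (x ⊕ y)

dist-act : ∀ {n} (k : Aut n) x y → dist (act k x) (act k y) ≡ dist x y
dist-act (a , σ) x y = begin
  wt ((permute σ x ⊕ a) ⊕ (permute σ y ⊕ a))
    ≡⟨ cong (λ v → wt ((permute σ x ⊕ a) ⊕ v)) (⊕-comm (permute σ y) a) ⟩
  wt ((permute σ x ⊕ a) ⊕ (a ⊕ permute σ y)) ≡⟨ cong wt (⊕-telescope (permute σ x) a (permute σ y)) ⟩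
  wt (permute σ x ⊕ permute σ y)             ≡⟨ cong wt (permute-⊕ σ x y) ⟨
  wt (permute σ (x ⊕ y))                     ≡⟨ wt-permute σ (x ⊕ y) ⟩
  wt (x ⊕ y)                                 ∎
  where open ≡-Reasoning

dist-self : ∀ {n} (x : V n) → dist x x ≡ 0
dist-self []          = refl
dist-self (true ∷ x)  = dist-self x
dist-self (false ∷ x) = dist-self x

dist-comm : ∀ {n} (x y : V n) → dist x y ≡ dist y x
dist-comm x y = cong wt (⊕-comm x y)

wt-⊕-≤ : ∀ {n} (u v : V n) → wt (u ⊕ v) ≤ wt u + wt v
wt-⊕-≤ []          []          = z≤n
wt-⊕-≤ (false ∷ u) (false ∷ v) = wt-⊕-≤ u v
wt-⊕-≤ (false ∷ u) (true ∷ v)  = ≤-trans (s≤s (wt-⊕-≤ u v)) (≤-reflexive (sym (+-suc (wt u) (wt v))))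
wt-⊕-≤ (true ∷ u)  (false ∷ v) = s≤s (wt-⊕-≤ u v)
wt-⊕-≤ (true ∷ u)  (true ∷ v)  =
  m≤n⇒m≤1+n (≤-trans (wt-⊕-≤ u v) (+-monoʳ-≤ (wt u) (n≤1+n (wt v))))

dist-triangle : ∀ {n} (x y z : V n) → dist x z ≤ dist x y + dist y z
dist-triangle x y z =
  subst (λ v → wt v ≤ dist x y + dist y z) (⊕-telescope x y z) (wt-⊕-≤ (x ⊕ y) (y ⊕ z))

WalkQ : ∀ {n} → ℕ → V n → V n → Set
WalkQ = Walk _≡_ AdjQ

walkQ-∷ : ∀ {n} m b {x y : V n} → WalkQ m x y → WalkQ m (b ∷ x) (b ∷ y)
walkQ-∷ zero    b     refl           = refl
walkQ-∷ (suc m) true  (v , adj , w) = true ∷ v , adj , walkQ-∷ m true w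
walkQ-∷ (suc m) false (v , adj , w) = false ∷ v , adj , walkQ-∷ m false w

geodesic : ∀ {n} (x y : V n) → WalkQ (dist x y) x y
geodesic []          []          = refl
geodesic (true ∷ x)  (true ∷ y)  = walkQ-∷ (dist x y) true (geodesic x y)
geodesic (false ∷ x) (false ∷ y) = walkQ-∷ (dist x y) false (geodesic x y)
geodesic (true ∷ x)  (false ∷ y) = false ∷ x , cong suc (dist-self x) , walkQ-∷ (dist x y) false (geodesic x y)
geodesic (false ∷ x) (true ∷ y)  = true ∷ x , cong suc (dist-self x) , walkQ-∷ (dist x y) true (geodesic x y)

DistQ≥⇒≤dist : ∀ {n} {x y : V n} {m} → DistQ≥ x y m → m ≤ dist x y
DistQ≥⇒≤dist {x = x} {y} no-shorter = ≮⇒≥ λ d<m → no-shorter (dist x y) d<m (geodesic x y)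

dK≥-mono : ∀ {n} {K : Aut n → Set} {m m′} → m ≤ m′ → dK≥ K m′ → dK≥ K m
dK≥-mono m≤m′ dK x k k∈K k≠1 j j<m = dK x k k∈K k≠1 j (<-≤-trans j<m m≤m′)

dK≥⇒orbit-separated : ∀ {n} {K : Aut n → Set} {m} → dK≥ K m →
                      ∀ {w z} → SameOrbit K w z → w ≢ z → m ≤ dist w z
dK≥⇒orbit-separated dK {w} (k , k∈K , refl) w≢kw =
  DistQ≥⇒≤dist (dK w k k∈K (λ k≡1 → w≢kw (sym (act-identity k k≡1 w))))

AdjacentInDistinctOrbits : ∀ {n} → (Aut n → Set) → Set
AdjacentInDistinctOrbits K = ∀ a b → AdjQ a b → ¬ SameOrbit K a b

dK≥2⇒adjacent-in-distinct-orbits : ∀ {n} {K : Aut n → Set} → dK≥ K 2 → AdjacentInDistinctOrbits K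
dK≥2⇒adjacent-in-distinct-orbits dK a b adj a~b with ≡-dec Bool._≟_ a b
... | yes refl = 0≢1+n (trans (sym (dist-self a)) adj)
... | no a≢b   = <⇒≱ (s≤s (s≤s z≤n)) (subst (2 ≤_) adj (dK≥⇒orbit-separated dK a~b a≢b))

dK≥2ℓ⇒orbit-distance-lower-bound : ∀ {n} {K : Aut n → Set} {ℓ} → dK≥ K (2 * ℓ) →
                                   ∀ {x w z} → dist x w ≡ ℓ → SameOrbit K w z → ℓ ≤ dist x z
dK≥2ℓ⇒orbit-distance-lower-bound {ℓ = ℓ} dK {x} {w} {z} xw≡ℓ w~z with ≡-dec Bool._≟_ w z
... | yes refl = ≤-reflexive (sym xw≡ℓ)
... | no w≢z   = +-cancelˡ-≤ ℓ ℓ (dist x z) (begin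
  ℓ + ℓ              ≡⟨ cong (ℓ +_) (+-identityʳ ℓ) ⟨
  2 * ℓ              ≤⟨ dK≥⇒orbit-separated dK w~z w≢z ⟩
  dist w z           ≤⟨ dist-triangle w x z ⟩
  dist w x + dist x z ≡⟨ cong (_+ dist x z) (trans (dist-comm w x) xw≡ℓ) ⟩
  ℓ + dist x z       ∎)
  where open ≤-Reasoning

IsOrbitDistance : ∀ {n} → (Aut n → Set) → V n → V n → ℕ → Set
IsOrbitDistance K x y m =
  (∃ λ z → SameOrbit K y z × dist x z ≡ m) × (∀ z → SameOrbit K y z → m ≤ dist x z)

module _ {n} {K : Aut n → Set} (K≤Aut : IsSubgroup K) where
  open IsSubgroup K≤Aut

  orbit-refl : ∀ x → SameOrbit K x x
  orbit-refl x = one , one∈ , act-one x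

  orbit-sym : ∀ {x y} → SameOrbit K x y → SameOrbit K y x
  orbit-sym {x} (k , k∈K , refl) = inv k , inv∈ k∈K , act-inv k x

  orbit-trans : ∀ {x y z} → SameOrbit K x y → SameOrbit K y z → SameOrbit K x z
  orbit-trans {x} (k , k∈K , refl) (k′ , k′∈K , refl) = k · k′ , ·∈ k∈K k′∈K , act-· k k′ x

  WalkΠ : ℕ → V n → V n → Set
  WalkΠ = Walk (SameOrbit K) (AdjΠ K)

  walkΠ-respʳ : ∀ m {u v w} → WalkΠ m u v → SameOrbit K v w → WalkΠ m u w
  walkΠ-respʳ zero    {u} {v} {w} u~v v~w = orbit-trans {u} {v} {w} u~v v~w
  walkΠ-respʳ (suc m) (u′ , adj , p) v~w = u′ , adj , walkΠ-respʳ m p v~w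

  adjΠ⇒adjQ-translate : ∀ {u w} → AdjΠ K u w → ∃ λ g → K g × AdjQ u (act g w)
  adjΠ⇒adjQ-translate {u} {w} (_ , _ , _ , (k , k∈K , refl) , (k′ , k′∈K , refl) , adj) =
    k′ · inv k , ·∈ k′∈K (inv∈ k∈K) , (begin
      dist u (act (k′ · inv k) w)
        ≡⟨ cong₂ dist (sym (act-inv k u)) (act-· k′ (inv k) w) ⟩
      dist (act (inv k) (act k u)) (act (inv k) (act k′ w))
        ≡⟨ dist-act (inv k) (act k u) (act k′ w) ⟩
      dist (act k u) (act k′ w)
        ≡⟨ adj ⟩
      1 ∎)
    where open ≡-Reasoning

  lift-walkΠ : ∀ j {u v} → WalkΠ j u v → ∃ λ z → SameOrbit K v z × dist u z ≤ j
  lift-walkΠ zero    {u} {v} u~v = u , orbit-sym {u} {v} u~v , ≤-reflexive (dist-self u)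
  lift-walkΠ (suc j) {u} {v} (w , adj , p)
    with adjΠ⇒adjQ-translate {u} {w} adj | lift-walkΠ j {w} {v} p
  ... | g , g∈K , u-gw | z , v~z , wz≤j =
    act g z , orbit-trans {v} {z} {act g z} v~z (g , g∈K , refl) , (begin
      dist u (act g z)                            ≤⟨ dist-triangle u (act g w) (act g z) ⟩
      dist u (act g w) + dist (act g w) (act g z) ≡⟨ cong₂ _+_ u-gw (dist-act g w z) ⟩
      1 + dist w z                                ≤⟨ s≤s wz≤j ⟩
      suc j                                       ∎)
    where open ≤-Reasoning

  module _ (separated : AdjacentInDistinctOrbits K) where

    project-walkQ : ∀ m {u v} → WalkQ m u v → WalkΠ m u v
    project-walkQ zero    {u} refl              = orbit-refl u
    project-walkQ (suc m) {u} {v} (w , adj , p) =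
      w , (separated u w adj , u , w , orbit-refl u , orbit-refl w , adj) , project-walkQ m p

    walkΠ-to-orbit : ∀ x z {y} → SameOrbit K y z → WalkΠ (dist x z) x y
    walkΠ-to-orbit x z {y} y~z =
      walkΠ-respʳ (dist x z) {x} {z} {y} (project-walkQ (dist x z) (geodesic x z)) (orbit-sym {y} {z} y~z)

    DistΠ⇔orbit-distance : ∀ {x y m} → Dist (SameOrbit K) (AdjΠ K) x y m ⇔ IsOrbitDistance K x y m
    DistΠ⇔orbit-distance {x} {y} {m} = mk⇔ to from
      where
      to : Dist (SameOrbit K) (AdjΠ K) x y m → IsOrbitDistance K x y m
      to (walk , no-shorter) with lift-walkΠ m {x} {y} walk
      ... | z , y~z , xz≤m = (z , y~z , ≤-antisym xz≤m (lower z y~z)) , lower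
        where
        lower : ∀ z′ → SameOrbit K y z′ → m ≤ dist x z′
        lower z′ y~z′ = ≮⇒≥ λ d<m → no-shorter (dist x z′) d<m (walkΠ-to-orbit x z′ y~z′)
      from : IsOrbitDistance K x y m → Dist (SameOrbit K) (AdjΠ K) x y m
      from ((z , y~z , xz≡m) , lower) =
        subst (λ j → WalkΠ j x y) xz≡m (walkΠ-to-orbit x z y~z) , no-shorter
        where
        no-shorter : ∀ j → j < m → ¬ WalkΠ j x y
        no-shorter j j<m walk with lift-walkΠ j {x} {y} walk
        ... | z′ , y~z′ , xz′≤j = <⇒≱ j<m (≤-trans (lower z′ y~z′) xz′≤j)

  orbit-distance⇔translate : ∀ {ℓ} → dK≥ K (2 * ℓ) → ∀ {x y} →
                            IsOrbitDistance K x y ℓ ⇔ (∃ λ e → wt e ≡ ℓ × SameOrbit K (x ⊕ e) y)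
  orbit-distance⇔translate {ℓ} dK {x} {y} = mk⇔ to from
    where
    to : IsOrbitDistance K x y ℓ → ∃ λ e → wt e ≡ ℓ × SameOrbit K (x ⊕ e) y
    to ((z , y~z , xz≡ℓ) , _) =
      x ⊕ z , xz≡ℓ , subst (λ v → SameOrbit K v y) (sym (⊕-cancelˡ x z)) (orbit-sym {y} {z} y~z)
    from : (∃ λ e → wt e ≡ ℓ × SameOrbit K (x ⊕ e) y) → IsOrbitDistance K x y ℓ
    from (e , wt-e≡ℓ , x+e~y) =
      (x ⊕ e , orbit-sym {x ⊕ e} {y} x+e~y , x-x+e≡ℓ) ,
      λ z y~z → dK≥2ℓ⇒orbit-distance-lower-bound dK {x} {x ⊕ e} {z} x-x+e≡ℓ
                  (orbit-trans {x ⊕ e} {y} {z} x+e~y y~z)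
      where
      x-x+e≡ℓ : dist x (x ⊕ e) ≡ ℓ
      x-x+e≡ℓ = trans (cong wt (⊕-cancelˡ x e)) wt-e≡ℓ

lemma3p4 : ∀ (n : ℕ) (K : Aut n → Set) → IsSubgroup K →
    ∀ (ℓ : ℕ) → 1 ≤ ℓ → dK≥ K (2 * ℓ) →
    ∀ (x y : V n) →
      InSphereΠ K ℓ x y ⇔ (∃ λ (e : V n) → wt e ≡ ℓ × SameOrbit K (x ⊕ e) y)
lemma3p4 n K K≤Aut ℓ ℓ≥1 dK x y =
  ⇔.trans (DistΠ⇔orbit-distance K≤Aut separated {x} {y} {ℓ})
          (orbit-distance⇔translate K≤Aut dK {x} {y})
  where
  separated : AdjacentInDistinctOrbits K
  separated = dK≥2⇒adjacent-in-distinct-orbits (dK≥-mono (*-monoʳ-≤ 2 ℓ≥1) dK)
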